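{- Let $n,l,k$ be natural numbers. If $x^{e(l,k)}+(x+1)^{e(l,k)}+1$ vanishes for some $x\in\mathbb{F}_{2^n}$, then $x\in\mathbb{F}_{2^{\gcd(jk,n)}}$ for some $j\in\{2,3,\ldots,l\}$. In particular, if $\gcd(jk,n)=1$ for all $j\in\{2,3,\ldots,l\}$, then $x^{e(l,k)}$ is $0$-APN over $\mathbb{F}_{2^n}$.
   Context: For natural numbers $l,k$, $e(l,k)=\sum_{j=0}^{l-1}2^{jk}$. A function $F:\mathbb{F}_{2^n}\to\mathbb{F}_{2^n}$ is $0$-APN if every pair $y,z\in\mathbb{F}_{2^n}$ with $F(0)+F(y)+F(z)+F(y+z)=0$ satisfies $yz(y+z)=0$. -}

module Defs where

open import Level using (0ℓ)
open import Data.Nat as ℕ using (ℕ; zero; suc)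
open import Data.Fin using (Fin)
open import Data.Product using (Σ; _,_)
open import Relation.Binary.PropositionalEquality using (_≡_)
open import Relation.Nullary using (¬_)
open import Algebra.Structures using (IsCommutativeRing)
open import Function.Bundles using (_↔_)

e : ℕ → ℕ → ℕ
e zero    k = 0
e (suc l) k = e l k ℕ.+ 2 ℕ.^ (l ℕ.* k)

record FiniteField (n : ℕ) : Set₁ where
  infixl 6 _+_
  infixl 7 _*_
  field
    Carrier : Set
    _+_ _*_ : Carrier → Carrier → Carrier
    -_      : Carrier → Carrier
    0# 1#   : Carrier
    isCommutativeRing : IsCommutativeRing _≡_ _+_ _*_ -_ 0# 1#
    0≢1     : ¬ (0# ≡ 1#)
    inverse : ∀ x → ¬ (x ≡ 0#) → Σ Carrier (λ y → x * y ≡ 1#)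
    card    : Carrier ↔ Fin (2 ℕ.^ n)

  infixr 8 _^_
  _^_ : Carrier → ℕ → Carrier
  x ^ zero  = 1#
  x ^ suc m = x * (x ^ m)

  -- x ∈ 𝔽_{2^d} ⊆ 𝔽_{2^n}  (for d ∣ n, the subfield 𝔽_{2^d} is {x | x^{2^d} = x})
  InSubfield : ℕ → Carrier → Set
  InSubfield d x = x ^ (2 ℕ.^ d) ≡ x

  ZeroAPN : (Carrier → Carrier) → Set
  ZeroAPN F = ∀ y z → F 0# + F y + F z + F (y + z) ≡ 0# → y * z * (y + z) ≡ 0#

module Submission where

-- Put E = e(l,k), P = x^E and xˡ = x^(2^(lk)). Since E·2^k + 1 = E + 2^(lk), every y satisfies
-- (y^E)^(2^k) · y = y^E · y^(2^(lk)). For a root x we have (x+1)^E = P + 1, and this identity at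
-- y = x and y = x + 1 combines, in characteristic 2, into (x + xˡ)(P + x) = 0. So either
-- x ∈ 𝔽_{2^(lk)}, or P = x, which for x ≠ 0 cancels to x ∈ 𝔽_{2^((l-1)k)} (and 𝔽_{2^k} ⊆ 𝔽_{2^(2k)}
-- when l = 2). Every x lies in 𝔽_{2^n} by Fermat, and a Bézout combination of the two Frobenius
-- fixed-point equations gives x ∈ 𝔽_{2^gcd(jk,n)}. For 0-APN, z = xy with y ≠ 0 turns the APN
-- equation into y^E times the root equation, and x ∈ 𝔽₂ means z ∈ {0, y}.

open import Defs
open import Level using (0ℓ)
open import Data.Nat as ℕ using (ℕ; zero; suc; _≤_; s≤s; z≤n; NonZero)
import Data.Nat.Properties as ℕₚ
open import Data.Nat.GCD using (gcd; gcd-GCD; module Bézout)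
import Data.Nat.Solver
open import Data.Bool using (Bool; true; false; _xor_; _∧_)
open import Data.Maybe using (Maybe; just; nothing)
open import Data.Fin using (Fin; punchIn)
import Data.Fin.Properties as Finₚ
open import Data.Vec.Functional using (removeAt)
open import Data.Product using (_×_; ∃-syntax; _,_; proj₁; proj₂)
open import Data.Sum using (_⊎_; inj₁; inj₂; [_,_]′)
open import Function.Base using (id)
open import Relation.Nullary using (¬_; Dec; yes; no; contradiction)
open import Relation.Binary.PropositionalEquality
open import Function.Bundles using (Inverse; Injection; _↔_; mk↔ₛ′)
open import Function.Properties.Inverse using (↔-sym; ↔-trans; ↔⇒↣)
open import Algebra.Structures using (IsCommutativeRing)
open import Algebra.Bundles using (CommutativeRing; RawRing)
import Algebra.Solver.Ring
import Algebra.Solver.Ring.AlmostCommutativeRing as ACR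

e*2^k+1≡e+2^lk : ∀ l k → e l k ℕ.* 2 ℕ.^ k ℕ.+ 1 ≡ e l k ℕ.+ 2 ℕ.^ (l ℕ.* k)
e*2^k+1≡e+2^lk zero    k = refl
e*2^k+1≡e+2^lk (suc l) k = begin
  (E ℕ.+ T) ℕ.* K ℕ.+ 1   ≡⟨ solve 3 (λ E T K → (E :+ T) :* K :+ con 1 := (E :* K :+ con 1) :+ T :* K) refl E T K ⟩
  (E ℕ.* K ℕ.+ 1) ℕ.+ T ℕ.* K ≡⟨ cong₂ ℕ._+_ (e*2^k+1≡e+2^lk l k) (ℕₚ.*-comm T K) ⟩
  (E ℕ.+ T) ℕ.+ K ℕ.* T   ≡⟨ cong ((E ℕ.+ T) ℕ.+_) (ℕₚ.^-distribˡ-+-* 2 k (l ℕ.* k)) ⟨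
  (E ℕ.+ T) ℕ.+ 2 ℕ.^ (k ℕ.+ l ℕ.* k) ∎
  where
  open ≡-Reasoning
  open Data.Nat.Solver.+-*-Solver
  E = e l k
  T = 2 ℕ.^ (l ℕ.* k)
  K = 2 ℕ.^ k

e-nonZero : ∀ l k → NonZero (e (suc l) k)
e-nonZero l k = ℕ.>-nonZero (ℕₚ.≤-trans (ℕₚ.m^n>0 2 (l ℕ.* k)) (ℕₚ.m≤n+m _ (e l k)))

module _ {n : ℕ} (F : FiniteField n) where
  open FiniteField F
  open IsCommutativeRing isCommutativeRing
    using ( +-identityˡ; +-identityʳ; -‿inverseʳ
          ; *-identityˡ; *-identityʳ; *-assoc; *-comm; zeroˡ; zeroʳ )
  open ≡-Reasoning

  commutativeRing : CommutativeRing 0ℓ 0ℓ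
  commutativeRing = record { isCommutativeRing = isCommutativeRing }

  open CommutativeRing commutativeRing using (ring; commutativeSemiring; *-commutativeMonoid)
  open import Algebra.Properties.Ring ring using (x[y-z]≈xy-xz; x≈y⇒x∙y⁻¹≈ε; x∙y⁻¹≈ε⇒x≈y; -1*x≈-x; -‿involutive; -0#≈0#)
  import Algebra.Properties.CommutativeSemiring.Exp commutativeSemiring as Exp
  open import Algebra.Properties.CommutativeMonoid.Sum *-commutativeMonoid
    using (sum-cong-≗; sum-permute; sum-remove; ∑-distrib-+; sum-replicate)
    renaming (sum to ∏)

  infix 4 _≟_
  _≟_ : (a b : Carrier) → Dec (a ≡ b)
  _≟_ = Finₚ.inj⇒≟ (↔⇒↣ card)

  ^≗Exp^ : ∀ x m → x ^ m ≡ x Exp.^ m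
  ^≗Exp^ x zero    = refl
  ^≗Exp^ x (suc m) = cong (x *_) (^≗Exp^ x m)

  ^-homo-* : ∀ x a b → x ^ (a ℕ.+ b) ≡ x ^ a * x ^ b
  ^-homo-* x a b rewrite ^≗Exp^ x (a ℕ.+ b) | ^≗Exp^ x a | ^≗Exp^ x b = Exp.^-homo-* x a b

  ^-assocʳ : ∀ x a b → (x ^ a) ^ b ≡ x ^ (a ℕ.* b)
  ^-assocʳ x a b rewrite ^≗Exp^ x (a ℕ.* b) | ^≗Exp^ x a | ^≗Exp^ (x Exp.^ a) b = Exp.^-assocʳ x a b

  ^-distrib-* : ∀ x y m → (x * y) ^ m ≡ x ^ m * y ^ m
  ^-distrib-* x y m rewrite ^≗Exp^ (x * y) m | ^≗Exp^ x m | ^≗Exp^ y m = Exp.^-distrib-* x y m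

  1^ : ∀ m → 1# ^ m ≡ 1#
  1^ zero    = refl
  1^ (suc m) = trans (*-identityˡ _) (1^ m)

  0^ : ∀ m → .{{NonZero m}} → 0# ^ m ≡ 0#
  0^ (suc m) = zeroˡ _

  x*y≡0⇒x≡0⊎y≡0 : ∀ {x y} → x * y ≡ 0# → x ≡ 0# ⊎ y ≡ 0#
  x*y≡0⇒x≡0⊎y≡0 {x} {y} xy≡0 with x ≟ 0#
  ... | yes x≡0 = inj₁ x≡0
  ... | no  x≢0 = inj₂ (begin
    y              ≡⟨ *-identityˡ y ⟨
    1# * y         ≡⟨ cong (_* y) (trans (*-comm x⁻¹ x) x*x⁻¹≡1) ⟨
    (x⁻¹ * x) * y  ≡⟨ *-assoc x⁻¹ x y ⟩
    x⁻¹ * (x * y)  ≡⟨ cong (x⁻¹ *_) xy≡0 ⟩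
    x⁻¹ * 0#       ≡⟨ zeroʳ x⁻¹ ⟩
    0#             ∎)
    where
    x⁻¹ = proj₁ (inverse x x≢0)
    x*x⁻¹≡1 = proj₂ (inverse x x≢0)

  *-≢0 : ∀ {x y} → ¬ x ≡ 0# → ¬ y ≡ 0# → ¬ x * y ≡ 0#
  *-≢0 x≢0 y≢0 xy≡0 with x*y≡0⇒x≡0⊎y≡0 xy≡0
  ... | inj₁ x≡0 = x≢0 x≡0
  ... | inj₂ y≡0 = y≢0 y≡0

  ^-≢0 : ∀ {x} m → ¬ x ≡ 0# → ¬ x ^ m ≡ 0#
  ^-≢0 zero    _   1≡0 = 0≢1 (sym 1≡0)
  ^-≢0 (suc m) x≢0     = *-≢0 x≢0 (^-≢0 m x≢0)

  *-cancelˡ : ∀ {x y z} → ¬ x ≡ 0# → x * y ≡ x * z → y ≡ z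
  *-cancelˡ {x} {y} {z} x≢0 xy≡xz
    with x*y≡0⇒x≡0⊎y≡0 (trans (x[y-z]≈xy-xz x y z) (x≈y⇒x∙y⁻¹≈ε xy≡xz))
  ... | inj₁ x≡0   = contradiction x≡0 x≢0
  ... | inj₂ y-z≡0 = x∙y⁻¹≈ε⇒x≈y y z y-z≡0

  ∏-≢0 : ∀ {m} (f : Fin m → Carrier) → (∀ i → ¬ f i ≡ 0#) → ¬ ∏ f ≡ 0#
  ∏-≢0 {zero}  f _     1≡0 = 0≢1 (sym 1≡0)
  ∏-≢0 {suc m} f f≢0 = *-≢0 (f≢0 Fin.zero) (∏-≢0 (λ i → f (Fin.suc i)) (λ i → f≢0 (Fin.suc i)))

  ∏-const : ∀ m x → ∏ {m} (λ _ → x) ≡ x ^ m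
  ∏-const m x = trans (sum-replicate m) (sym (^≗Exp^ x m))

  ifNonzero : Carrier → Carrier → Carrier
  ifNonzero y a with y ≟ 0#
  ... | yes _ = 1#
  ... | no  _ = a

  ifNonzero-0 : ∀ a → ifNonzero 0# a ≡ 1#
  ifNonzero-0 a with 0# ≟ 0#
  ... | yes _   = refl
  ... | no  0≢0 = contradiction refl 0≢0

  ifNonzero-≢0 : ∀ {y} a → ¬ y ≡ 0# → ifNonzero y a ≡ a
  ifNonzero-≢0 {y} a y≢0 with y ≟ 0#
  ... | yes y≡0 = contradiction y≡0 y≢0
  ... | no  _   = refl

  ifNonzero-self-≢0 : ∀ y → ¬ ifNonzero y y ≡ 0#
  ifNonzero-self-≢0 y with y ≟ 0#
  ... | yes _   = λ 1≡0 → 0≢1 (sym 1≡0)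
  ... | no  y≢0 = y≢0

  ifNonzero-* : ∀ {x} y → ¬ x ≡ 0# → ifNonzero (x * y) (x * y) ≡ ifNonzero y x * ifNonzero y y
  ifNonzero-* {x} y x≢0 with y ≟ 0#
  ... | yes refl = trans (cong (λ t → ifNonzero t t) (zeroʳ x)) (trans (ifNonzero-0 0#) (sym (*-identityˡ 1#)))
  ... | no  y≢0  = ifNonzero-≢0 (x * y) (*-≢0 x≢0 y≢0)

  -- Multiplication by x ≠ 0 permutes the field, so ∏ ifNonzero y y over all y is unchanged;
  -- comparing both sides leaves x ^ (N - 1) = 1.
  ^-pred-card≡1 : ∀ {M} → Carrier ↔ Fin (suc M) → ∀ {x} → ¬ x ≡ 0# → x ^ M ≡ 1#
  ^-pred-card≡1 {M} c {x} x≢0 = begin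
    x ^ M                    ≡⟨ ∏-const M x ⟨
    ∏ {M} (λ _ → x)          ≡⟨ sum-cong-≗ (λ j → sym (h-punchIn j)) ⟩
    ∏ (removeAt h i₀)        ≡⟨ *-identityˡ _ ⟨
    1# * ∏ (removeAt h i₀)   ≡⟨ cong (_* ∏ (removeAt h i₀)) (sym (trans (cong (λ y → ifNonzero y x) (from∘to 0#)) (ifNonzero-0 x))) ⟩
    h i₀ * ∏ (removeAt h i₀) ≡⟨ sym (sum-remove h) ⟩
    ∏ h                      ≡⟨ *-cancelˡ (∏-≢0 g (λ i → ifNonzero-self-≢0 (from i))) ∏g≡∏g*∏h ⟩
    1#                       ∎
    where
    open Inverse c using (to; from) renaming (strictlyInverseˡ to to∘from; strictlyInverseʳ to from∘to)
    x⁻¹ = proj₁ (inverse x x≢0)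
    x*x⁻¹≡1 = proj₂ (inverse x x≢0)

    x*-↔ : Carrier ↔ Carrier
    x*-↔ = mk↔ₛ′ (x *_) (x⁻¹ *_) (cancel x x⁻¹ x*x⁻¹≡1) (cancel x⁻¹ x (trans (*-comm x⁻¹ x) x*x⁻¹≡1))
      where
      cancel : ∀ a b → a * b ≡ 1# → ∀ y → a * (b * y) ≡ y
      cancel a b ab≡1 y = trans (sym (*-assoc a b y)) (trans (cong (_* y) ab≡1) (*-identityˡ y))

    g h : Fin (suc M) → Carrier
    g i = ifNonzero (from i) (from i)
    h i = ifNonzero (from i) x
    i₀ = to 0#

    h-punchIn : ∀ j → h (punchIn i₀ j) ≡ x
    h-punchIn j = ifNonzero-≢0 x λ from≡0 →
      Finₚ.punchInᵢ≢i i₀ j (trans (sym (to∘from _)) (cong to from≡0))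

    ∏g≡∏g*∏h : ∏ g * ∏ h ≡ ∏ g * 1#
    ∏g≡∏g*∏h = begin
      ∏ g * ∏ h                                 ≡⟨ *-comm (∏ g) (∏ h) ⟩
      ∏ h * ∏ g                                 ≡⟨ ∑-distrib-+ h g ⟨
      ∏ (λ i → h i * g i)                       ≡⟨ sum-cong-≗ (λ i → sym (ifNonzero-* (from i) x≢0)) ⟩
      ∏ (λ i → ifNonzero (x * from i) (x * from i)) ≡⟨ sum-cong-≗ (λ i → cong (λ y → ifNonzero y y) (from∘to (x * from i))) ⟨
      ∏ (λ i → g (to (x * from i)))             ≡⟨ sum-permute g (↔-trans (↔-sym c) (↔-trans x*-↔ c)) ⟨
      ∏ g                                       ≡⟨ *-identityʳ (∏ g) ⟨
      ∏ g * 1#                                  ∎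

  ^-card : ∀ {N} → Carrier ↔ Fin N → ∀ x → x ^ N ≡ x
  ^-card {zero}  c x with Inverse.to c x
  ... | ()
  ^-card {suc M} c x with x ≟ 0#
  ... | yes refl = 0^ (suc M)
  ... | no  x≢0  = trans (cong (x *_) (^-pred-card≡1 c x≢0)) (*-identityʳ x)

  InSubfield-n : ∀ x → InSubfield n x
  InSubfield-n = ^-card card

  -- Characteristic 2: -1 = (-1)^(2^m) = 1 once m ≥ 1, and a one-element field is impossible.
  1+1≡0 : 1# + 1# ≡ 0#
  1+1≡0 = fieldOfSize2^ n card InSubfield-n
    where
    fieldOfSize2^ : ∀ m → Carrier ↔ Fin (2 ℕ.^ m) → (∀ x → InSubfield m x) → 1# + 1# ≡ 0#
    fieldOfSize2^ zero c _ = contradiction (Injection.injective (↔⇒↣ c) (fin1 (Inverse.to c 0#) (Inverse.to c 1#))) 0≢1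
      where
      fin1 : (i j : Fin 1) → i ≡ j
      fin1 Fin.zero Fin.zero = refl
    fieldOfSize2^ (suc m) _ frob≡id = trans (cong (1# +_) (sym -1≡1)) (-‿inverseʳ 1#)
      where
      -1≡1 : - 1# ≡ 1#
      -1≡1 = begin
        - 1#                            ≡⟨ frob≡id (- 1#) ⟨
        (- 1#) ^ (2 ℕ.* 2 ℕ.^ m)        ≡⟨ ^-assocʳ (- 1#) 2 (2 ℕ.^ m) ⟨
        ((- 1#) ^ 2) ^ (2 ℕ.^ m)        ≡⟨ cong (λ y → (- 1# * y) ^ (2 ℕ.^ m)) (*-identityʳ (- 1#)) ⟩
        (- 1# * - 1#) ^ (2 ℕ.^ m)       ≡⟨ cong (_^ (2 ℕ.^ m)) (trans (-1*x≈-x (- 1#)) (-‿involutive 1#)) ⟩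
        1# ^ (2 ℕ.^ m)                  ≡⟨ 1^ (2 ℕ.^ m) ⟩
        1#                              ∎

  -- A ring solver with coefficients in 𝔽₂ = (Bool, xor, ∧), sound because 1 + 1 = 0.
  module 𝔽₂-Solver where
    ⟦_⟧₂ : Bool → Carrier
    ⟦ true  ⟧₂ = 1#
    ⟦ false ⟧₂ = 0#

    𝔽₂ : RawRing 0ℓ 0ℓ
    𝔽₂ = record { Carrier = Bool ; _≈_ = _≡_ ; _+_ = _xor_ ; _*_ = _∧_ ; -_ = λ b → b ; 0# = false ; 1# = true }

    -1≡1 : - 1# ≡ 1#
    -1≡1 = sym (x∙y⁻¹≈ε⇒x≈y 1# (- 1#) (trans (cong (1# +_) (-‿involutive 1#)) 1+1≡0))

    𝔽₂⟶ : 𝔽₂ ACR.-Raw-AlmostCommutative⟶ ACR.fromCommutativeRing commutativeRing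
    𝔽₂⟶ = record
      { ⟦_⟧    = ⟦_⟧₂
      ; +-homo = +-homo
      ; *-homo = *-homo
      ; -‿homo = -‿homo
      ; 0-homo = refl
      ; 1-homo = refl
      }
      where
      +-homo : ∀ a b → ⟦ a xor b ⟧₂ ≡ ⟦ a ⟧₂ + ⟦ b ⟧₂
      +-homo false b     = sym (+-identityˡ _)
      +-homo true  false = sym (+-identityʳ 1#)
      +-homo true  true  = sym 1+1≡0
      *-homo : ∀ a b → ⟦ a ∧ b ⟧₂ ≡ ⟦ a ⟧₂ * ⟦ b ⟧₂
      *-homo false b = sym (zeroˡ _)
      *-homo true  b = sym (*-identityˡ _)
      -‿homo : ∀ a → ⟦ a ⟧₂ ≡ - ⟦ a ⟧₂
      -‿homo false = sym -0#≈0#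
      -‿homo true  = sym -1≡1

    _≟₂_ : ∀ a b → Maybe (⟦ a ⟧₂ ≡ ⟦ b ⟧₂)
    true  ≟₂ true  = just refl
    false ≟₂ false = just refl
    _     ≟₂ _     = nothing

    open Algebra.Solver.Ring 𝔽₂ (ACR.fromCommutativeRing commutativeRing) 𝔽₂⟶ _≟₂_ public
      using (solve; _:+_; _:*_; con; _:=_)

  open 𝔽₂-Solver using (solve; _:+_; _:*_; con; _:=_)

  x+y≡0⇒x≡y : ∀ {x y} → x + y ≡ 0# → x ≡ y
  x+y≡0⇒x≡y {x} {y} x+y≡0 = begin
    x            ≡⟨ solve 2 (λ x y → x := (x :+ y) :+ y) refl x y ⟩
    (x + y) + y  ≡⟨ cong (_+ y) x+y≡0 ⟩
    0# + y       ≡⟨ +-identityˡ y ⟩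
    y            ∎

  x≡y⇒x+y≡0 : ∀ {x y} → x ≡ y → x + y ≡ 0#
  x≡y⇒x+y≡0 {x} refl = solve 1 (λ x → x :+ x := con false) refl x

  frob : ℕ → Carrier → Carrier
  frob m y = y ^ (2 ℕ.^ m)

  frob-suc : ∀ m y → frob (suc m) y ≡ frob m (y * y)
  frob-suc m y = trans (sym (^-assocʳ y 2 (2 ℕ.^ m))) (cong (λ t → (y * t) ^ (2 ℕ.^ m)) (*-identityʳ y))

  frob-+ : ∀ m a b → frob m (a + b) ≡ frob m a + frob m b
  frob-+ zero    a b = trans (*-identityʳ _) (sym (cong₂ _+_ (*-identityʳ a) (*-identityʳ b)))
  frob-+ (suc m) a b = begin
    frob (suc m) (a + b)             ≡⟨ frob-suc m (a + b) ⟩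
    frob m ((a + b) * (a + b))       ≡⟨ cong (frob m) (solve 2 (λ a b → (a :+ b) :* (a :+ b) := a :* a :+ b :* b) refl a b) ⟩
    frob m (a * a + b * b)           ≡⟨ frob-+ m (a * a) (b * b) ⟩
    frob m (a * a) + frob m (b * b)  ≡⟨ cong₂ _+_ (frob-suc m a) (frob-suc m b) ⟨
    frob (suc m) a + frob (suc m) b  ∎

  frob-0 : ∀ m → frob m 0# ≡ 0#
  frob-0 m = 0^ (2 ℕ.^ m) {{ℕₚ.m^n≢0 2 m}}

  frob-1 : ∀ m → frob m 1# ≡ 1#
  frob-1 m = 1^ (2 ℕ.^ m)

  frob-injective : ∀ m {a b} → frob m a ≡ frob m b → a ≡ b
  frob-injective m {a} {b} frob-a≡frob-b with a + b ≟ 0#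
  ... | yes a+b≡0 = x+y≡0⇒x≡y a+b≡0
  ... | no  a+b≢0 = contradiction (trans (frob-+ m a b) (x≡y⇒x+y≡0 frob-a≡frob-b)) (^-≢0 (2 ℕ.^ m) a+b≢0)

  frob-frob : ∀ a b y → frob b (frob a y) ≡ frob (a ℕ.+ b) y
  frob-frob a b y = begin
    (y ^ (2 ℕ.^ a)) ^ (2 ℕ.^ b)  ≡⟨ ^-assocʳ y (2 ℕ.^ a) (2 ℕ.^ b) ⟩
    y ^ (2 ℕ.^ a ℕ.* 2 ℕ.^ b)    ≡⟨ cong (y ^_) (ℕₚ.^-distribˡ-+-* 2 a b) ⟨
    y ^ (2 ℕ.^ (a ℕ.+ b))        ∎

  InSubfield-0# : ∀ d → InSubfield d 0#
  InSubfield-0# = frob-0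

  InSubfield-+ : ∀ {a b x} → InSubfield a x → InSubfield b x → InSubfield (a ℕ.+ b) x
  InSubfield-+ {a} {b} {x} x∈a x∈b = trans (sym (frob-frob a b x)) (trans (cong (frob b) x∈a) x∈b)

  InSubfield-* : ∀ c {a x} → InSubfield a x → InSubfield (c ℕ.* a) x
  InSubfield-* zero    {x = x} _   = *-identityʳ x
  InSubfield-* (suc c) {a}     x∈a = InSubfield-+ {a} {c ℕ.* a} x∈a (InSubfield-* c x∈a)

  InSubfield-+⁻¹ : ∀ {a b x} → InSubfield b x → InSubfield (a ℕ.+ b) x → InSubfield a x
  InSubfield-+⁻¹ {a} {b} {x} x∈b x∈a+b = frob-injective b (trans (frob-frob a b x) (trans x∈a+b (sym x∈b)))

  InSubfield-gcd : ∀ {a b x} → InSubfield a x → InSubfield b x → InSubfield (gcd a b) x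
  InSubfield-gcd {a} {b} {x} x∈a x∈b with Bézout.identity (gcd-GCD a b)
  ... | Bézout.+- u v d+vb≡ua = InSubfield-+⁻¹ {gcd a b} {v ℕ.* b} (InSubfield-* v x∈b) (subst (λ d → InSubfield d x) (sym d+vb≡ua) (InSubfield-* u x∈a))
  ... | Bézout.-+ u v d+ua≡vb = InSubfield-+⁻¹ {gcd a b} {u ℕ.* a} (InSubfield-* u x∈a) (subst (λ d → InSubfield d x) (sym d+ua≡vb) (InSubfield-* v x∈b))

  InSubfield-1⇒x*[x+1]≡0 : ∀ {x} → InSubfield 1 x → x * (x + 1#) ≡ 0#
  InSubfield-1⇒x*[x+1]≡0 {x} x²≡x = trans (solve 1 (λ x → x :* (x :+ con true) := x :* (x :* con true) :+ x) refl x) (x≡y⇒x+y≡0 x²≡x)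

  frob-^e : ∀ l k y → frob k (y ^ e l k) * y ≡ y ^ e l k * frob (l ℕ.* k) y
  frob-^e l k y = begin
    (y ^ E) ^ (2 ℕ.^ k) * y            ≡⟨ cong₂ _*_ (sym (^-assocʳ y E (2 ℕ.^ k))) (*-identityʳ y) ⟨
    y ^ (E ℕ.* 2 ℕ.^ k) * y ^ 1        ≡⟨ ^-homo-* y (E ℕ.* 2 ℕ.^ k) 1 ⟨
    y ^ (E ℕ.* 2 ℕ.^ k ℕ.+ 1)          ≡⟨ cong (y ^_) (e*2^k+1≡e+2^lk l k) ⟩
    y ^ (E ℕ.+ 2 ℕ.^ (l ℕ.* k))        ≡⟨ ^-homo-* y E _ ⟩
    y ^ E * frob (l ℕ.* k) y           ∎
    where E = e l k

  module _ (l k : ℕ) {x : Carrier} (root : x ^ e l k + (x + 1#) ^ e l k + 1# ≡ 0#) where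
    private
      P  = x ^ e l k
      P′ = frob k P
      xˡ = frob (l ℕ.* k) x

    root⇒factorisation : (x + xˡ) * (P + x) ≡ 0#
    root⇒factorisation = begin
      (x + xˡ) * (P + x)
        ≡⟨ solve 4 (λ x xˡ P P′ → (x :+ xˡ) :* (P :+ x)
                     := (P′ :* x :+ P :* xˡ) :+ x :* (((P′ :+ con true) :* (x :+ con true) :+ (P :+ con true) :* (xˡ :+ con true)) :+ (P′ :* x :+ P :* xˡ)))
                   refl x xˡ P P′ ⟩
      (P′ * x + P * xˡ) + x * (((P′ + 1#) * (x + 1#) + (P + 1#) * (xˡ + 1#)) + (P′ * x + P * xˡ))
        ≡⟨ cong₂ (λ a b → a + x * (b + a)) (x≡y⇒x+y≡0 (frob-^e l k x)) (x≡y⇒x+y≡0 relation-at-x+1) ⟩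
      0# + x * (0# + 0#)
        ≡⟨ trans (+-identityˡ _) (trans (cong (x *_) (+-identityˡ 0#)) (zeroʳ x)) ⟩
      0# ∎
      where
      P+1≡Q : P + 1# ≡ (x + 1#) ^ e l k
      P+1≡Q = x+y≡0⇒x≡y (trans (solve 3 (λ P Q o → P :+ o :+ Q := P :+ Q :+ o) refl P ((x + 1#) ^ e l k) 1#) root)

      relation-at-x+1 : (P′ + 1#) * (x + 1#) ≡ (P + 1#) * (xˡ + 1#)
      relation-at-x+1 = begin
        (P′ + 1#) * (x + 1#)                   ≡⟨ cong (λ t → (P′ + t) * (x + 1#)) (frob-1 k) ⟨
        (P′ + frob k 1#) * (x + 1#)            ≡⟨ cong (_* (x + 1#)) (frob-+ k P 1#) ⟨
        frob k (P + 1#) * (x + 1#)             ≡⟨ cong (λ t → frob k t * (x + 1#)) P+1≡Q ⟩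
        frob k ((x + 1#) ^ e l k) * (x + 1#)   ≡⟨ frob-^e l k (x + 1#) ⟩
        (x + 1#) ^ e l k * frob (l ℕ.* k) (x + 1#)
          ≡⟨ cong₂ _*_ (sym P+1≡Q) (trans (frob-+ (l ℕ.* k) x 1#) (cong (xˡ +_) (frob-1 (l ℕ.* k)))) ⟩
        (P + 1#) * (xˡ + 1#)                   ∎

  ^e≡id⇒InSubfield : ∀ l k {x} → x ^ e (suc l) k ≡ x → ¬ x ≡ 0# → InSubfield (l ℕ.* k) x
  ^e≡id⇒InSubfield l k {x} P≡x x≢0 = sym (frob-injective k (*-cancelˡ x≢0 (begin
    x * frob k x                        ≡⟨ *-comm x _ ⟩
    frob k x * x                        ≡⟨ cong (λ t → frob k t * x) P≡x ⟨
    frob k (x ^ e (suc l) k) * x        ≡⟨ frob-^e (suc l) k x ⟩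
    x ^ e (suc l) k * frob (suc l ℕ.* k) x ≡⟨ cong₂ _*_ P≡x (cong (λ d → frob d x) (ℕₚ.+-comm k (l ℕ.* k))) ⟩
    x * frob (l ℕ.* k ℕ.+ k) x          ≡⟨ cong (x *_) (frob-frob (l ℕ.* k) k x) ⟨
    x * frob k (frob (l ℕ.* k) x)       ∎)))

  root⇒InSubfield : ∀ l k {x} → 2 ≤ l → x ^ e l k + (x + 1#) ^ e l k + 1# ≡ 0# →
    ∃[ j ] (2 ≤ j × j ≤ l × InSubfield (j ℕ.* k) x)
  root⇒InSubfield (suc (suc l)) k {x} 2≤l root with x*y≡0⇒x≡0⊎y≡0 (root⇒factorisation (suc (suc l)) k root)
  ... | inj₁ x+xˡ≡0 = suc (suc l) , 2≤l , ℕₚ.≤-refl , sym (x+y≡0⇒x≡y x+xˡ≡0)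
  ... | inj₂ P+x≡0 with x ≟ 0#
  ...   | yes refl = 2 , ℕₚ.≤-refl , 2≤l , InSubfield-0# (2 ℕ.* k)
  ...   | no  x≢0  = below-top l (^e≡id⇒InSubfield (suc l) k (x+y≡0⇒x≡y P+x≡0) x≢0)
    where
    below-top : ∀ m → InSubfield (suc m ℕ.* k) x → ∃[ j ] (2 ≤ j × j ≤ suc (suc m) × InSubfield (j ℕ.* k) x)
    below-top zero    x∈𝔽 = 2 , ℕₚ.≤-refl , ℕₚ.≤-refl , InSubfield-* 2 {k} (subst (λ d → InSubfield d x) (ℕₚ.*-identityˡ k) x∈𝔽)
    below-top (suc m) x∈𝔽 = suc (suc m) , s≤s (s≤s z≤n) , ℕₚ.n≤1+n _ , x∈𝔽
  root⇒InSubfield (suc zero) k (s≤s ()) root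

  power-ZeroAPN : ∀ E → .{{NonZero E}} →
    (∀ x → x ^ E + (x + 1#) ^ E + 1# ≡ 0# → x * (x + 1#) ≡ 0#) → ZeroAPN (λ x → x ^ E)
  power-ZeroAPN E roots y z h with y ≟ 0#
  ... | yes refl = trans (cong (_* (0# + z)) (zeroˡ z)) (zeroˡ _)
  ... | no  y≢0  = vanishes (x*y≡0⇒x≡0⊎y≡0 (roots x root))
    where
    x = z * proj₁ (inverse y y≢0)

    z≡xy : z ≡ x * y
    z≡xy = begin
      z                                      ≡⟨ *-identityʳ z ⟨
      z * 1#                                 ≡⟨ cong (z *_) (trans (*-comm _ y) (proj₂ (inverse y y≢0))) ⟨
      z * (proj₁ (inverse y y≢0) * y)        ≡⟨ *-assoc z _ y ⟨
      x * y                                  ∎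

    y+z≡[x+1]y : y + z ≡ (x + 1#) * y
    y+z≡[x+1]y = trans (cong (y +_) z≡xy) (solve 2 (λ x y → y :+ x :* y := (x :+ con true) :* y) refl x y)

    root*y^E≡0 : (x ^ E + (x + 1#) ^ E + 1#) * y ^ E ≡ 0#
    root*y^E≡0 = begin
      (x ^ E + (x + 1#) ^ E + 1#) * y ^ E
        ≡⟨ solve 3 (λ X X₁ Y → (X :+ X₁ :+ con true) :* Y := con false :+ Y :+ X :* Y :+ X₁ :* Y) refl (x ^ E) ((x + 1#) ^ E) (y ^ E) ⟩
      0# + y ^ E + x ^ E * y ^ E + (x + 1#) ^ E * y ^ E
        ≡⟨ cong₂ (λ a b → a + y ^ E + b + (x + 1#) ^ E * y ^ E) (0^ E) (^-distrib-* x y E) ⟨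
      0# ^ E + y ^ E + (x * y) ^ E + (x + 1#) ^ E * y ^ E
        ≡⟨ cong₂ (λ a b → 0# ^ E + y ^ E + a ^ E + b) z≡xy (^-distrib-* (x + 1#) y E) ⟨
      0# ^ E + y ^ E + z ^ E + ((x + 1#) * y) ^ E
        ≡⟨ cong (λ b → 0# ^ E + y ^ E + z ^ E + b ^ E) y+z≡[x+1]y ⟨
      0# ^ E + y ^ E + z ^ E + (y + z) ^ E
        ≡⟨ h ⟩
      0# ∎

    root : x ^ E + (x + 1#) ^ E + 1# ≡ 0#
    root = [ id , (λ y^E≡0 → contradiction y^E≡0 (^-≢0 E y≢0)) ]′ (x*y≡0⇒x≡0⊎y≡0 root*y^E≡0)

    vanishes : x ≡ 0# ⊎ x + 1# ≡ 0# → y * z * (y + z) ≡ 0#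
    vanishes (inj₁ x≡0) = begin
      y * z * (y + z)     ≡⟨ cong (λ t → y * t * (y + t)) (trans z≡xy (trans (cong (_* y) x≡0) (zeroˡ y))) ⟩
      y * 0# * (y + 0#)   ≡⟨ cong (_* (y + 0#)) (zeroʳ y) ⟩
      0# * (y + 0#)       ≡⟨ zeroˡ _ ⟩
      0#                  ∎
    vanishes (inj₂ x+1≡0) = begin
      y * z * (y + z)          ≡⟨ cong (y * z *_) y+z≡[x+1]y ⟩
      y * z * ((x + 1#) * y)   ≡⟨ cong (λ t → y * z * (t * y)) x+1≡0 ⟩
      y * z * (0# * y)         ≡⟨ cong (y * z *_) (zeroˡ y) ⟩
      y * z * 0#               ≡⟨ zeroʳ _ ⟩
      0#                       ∎

  root⇒InSubfield-gcd : ∀ l k {x} → 2 ≤ l → x ^ e l k + (x + 1#) ^ e l k + 1# ≡ 0# →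
    ∃[ j ] (2 ≤ j × j ≤ l × InSubfield (gcd (j ℕ.* k) n) x)
  root⇒InSubfield-gcd l k {x} 2≤l root with root⇒InSubfield l k 2≤l root
  ... | j , 2≤j , j≤l , x∈𝔽 = j , 2≤j , j≤l , InSubfield-gcd {j ℕ.* k} {n} x∈𝔽 (InSubfield-n x)

corollary1 : (n l k : ℕ) → 2 ≤ l → (F : FiniteField n) →
  let open FiniteField F in
  ((x : Carrier) → x ^ e l k + (x + 1#) ^ e l k + 1# ≡ 0# →
    ∃[ j ] (2 ≤ j × j ≤ l × InSubfield (gcd (j ℕ.* k) n) x))
  × ((∀ j → 2 ≤ j → j ≤ l → gcd (j ℕ.* k) n ≡ 1) → ZeroAPN (λ x → x ^ e l k))
corollary1 n l@(suc l′) k 2≤l F = (λ x → root⇒InSubfield-gcd F l k 2≤l) , zeroAPN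
  where
  open FiniteField F

  zeroAPN : (∀ j → 2 ≤ j → j ≤ l → gcd (j ℕ.* k) n ≡ 1) → ZeroAPN (λ x → x ^ e l k)
  zeroAPN coprime = power-ZeroAPN F (e l k) {{e-nonZero l′ k}} λ x root →
    let j , 2≤j , j≤l , x∈𝔽 = root⇒InSubfield-gcd F l k 2≤l root
    in InSubfield-1⇒x*[x+1]≡0 F (subst (λ d → InSubfield d x) (coprime j 2≤j j≤l) x∈𝔽)
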